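{- Let $T$ be a binary tree, rooted and embedded in the plane as in the context, and suppose $K_4T$ contains a complete subgraph $K_m$ with $m\ge 3$. Then $F(T)$ contains an independent set of $m$ vertices.
   Context: A binary tree here is a finite tree each of whose vertices has degree at most $3$. Let $T$ be embedded in the plane, rooted at a vertex $\star$ of degree one; $d(x)$ denotes the degree of $x$ in $T$. At each vertex $x$ the incident edges are numbered $0,1,\dots,d(x)-1$ via the embedding, edge $0$ being the edge at $x$ lying on the unique path from $x$ to $\star$. For distinct vertices $x,y$: $y$ lies on $x$-direction $i$ ($1\le i\le d(x)-1$) if $x$ lies on the unique path from $y$ to $\star$ and this path contains the $i$-th edge at $x$; then $x$ lies on $y$-direction $0$. If $x$ is not on the $y\star$ path and $y$ is not on the $x\star$ path, $x$ and $y$ are not stacked and each lies on the other's direction $0$; otherwise they are stacked. $F(T)$ is the tree with vertex set $\{x\in V(T): d(x)>2\}$, two of these vertices adjacent iff the path joining them in $T$ contains no other vertex of $F(T)$. $K_4T$: vertices are $4$-tuples $(k,x,p,q)$ with $x\in V(T)$, $d(x)\ge 3$, $k$ a non-negative integer, $p=(p_1,\dots,p_{l(p)})$, $q=(q_1,\dots,q_{l(q)})$ vectors of non-negative integers, $p$ having a positive entry, $l(p)+l(q)=d(x)-1$, and the sum of all entries of $p$ and $q$ equal to $3-k$. Vertices $v,w$ are adjacent iff for one ordering, writing $v=(k_1,x_1,p_1,q_1)$, $w=(k_2,x_2,p_2,q_2)$: (1) $x_1,x_2$ not stacked and $k_1+k_2\ge4$; or (2) $x_2$ lies on $x_1$-direction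 $i$, $1\le i\le l(p_1)$, and either $p_{1,i}>4-k_2$, or $p_{1,i}+k_2=4$ and $p_{1,j}\ne0$ for some $j\neq i$; or (3) $x_2$ lies on $x_1$-direction $i>l(p_1)$ and $q_{1,i-l(p_1)}>4-k_2$. -}

module Defs where

open import Data.Nat using (ℕ; zero; suc; _+_; _∸_; _≤_; _<_)
open import Data.Fin using (Fin; toℕ)
open import Data.Vec using (Vec; lookup; sum)
open import Data.Vec.Relation.Unary.Any using (Any)
open import Data.Product using (Σ; _×_; ∃)
open import Data.Sum using (_⊎_)
open import Relation.Nullary using (¬_)
open import Relation.Binary.PropositionalEquality using (_≡_; _≢_)

-- Plane binary trees rooted at a degree-one vertex ★.
--
-- A whole tree T is ★ together with the subtree `t : Tree` hanging from
-- the unique child of ★.  Every non-root vertex has a parent edge (edge 0)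
-- and at most two children, listed in the order given by the embedding
-- (children numbered 1, 2, … as edges 1, 2, … at that vertex).

data Tree : Set where
  leaf   : Tree
  unary  : Tree → Tree
  binary : Tree → Tree → Tree

-- Non-root vertices of T = ★ + t  (positions in t).
data Pos : Tree → Set where
  here  : ∀ {t} → Pos t
  down  : ∀ {t} → Pos t → Pos (unary t)
  left  : ∀ {l r} → Pos l → Pos (binary l r)
  right : ∀ {l r} → Pos r → Pos (binary l r)

-- degree in T (the parent edge is always present, ★ included)
deg : ∀ {t} → Pos t → ℕ
deg {leaf}       here = 1
deg {unary _}    here = 2
deg {binary _ _} here = 3
deg (down p)  = deg p
deg (left p)  = deg p
deg (right p) = deg p

data _≼_ : ∀ {t} → Pos t → Pos t → Set where
  here≼  : ∀ {t} {p : Pos t} → here ≼ p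
  down≼  : ∀ {t} {p q : Pos t} → p ≼ q → down p ≼ down q
  left≼  : ∀ {l r} {p q : Pos l} → p ≼ q → left {l} {r} p ≼ left q
  right≼ : ∀ {l r} {p q : Pos r} → p ≼ q → right {l} {r} p ≼ right q

Stacked : ∀ {t} → Pos t → Pos t → Set
Stacked x y = x ≼ y ⊎ y ≼ x

-- OnDir x i y : y lies on x-direction i  (1 ≤ i ≤ d(x) - 1)
data OnDir : ∀ {t} → Pos t → ℕ → Pos t → Set where
  dir-down  : ∀ {t} {p : Pos t} → OnDir (here {unary t}) 1 (down p)
  dir-left  : ∀ {l r} {p : Pos l} → OnDir (here {binary l r}) 1 (left p)
  dir-right : ∀ {l r} {p : Pos r} → OnDir (here {binary l r}) 2 (right p)
  in-down   : ∀ {t} {x y : Pos t} {i} → OnDir x i y → OnDir (down x) i (down y)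
  in-left   : ∀ {l r} {x y : Pos l} {i} → OnDir x i y → OnDir (left {l} {r} x) i (left y)
  in-right  : ∀ {l r} {x y : Pos r} {i} → OnDir x i y → OnDir (right {l} {r} x) i (right y)

OnPath : ∀ {t} → Pos t → Pos t → Pos t → Set
OnPath x y z = (z ≼ x ⊎ z ≼ y) × (∀ w → w ≼ x → w ≼ y → w ≼ z)

InF : ∀ {t} → Pos t → Set
InF x = 2 < deg x

-- adjacency in F(T) (for vertices x, y of F(T))
FAdj : ∀ {t} → Pos t → Pos t → Set
FAdj x y = x ≢ y × (∀ z → OnPath x y z → InF z → z ≡ x ⊎ z ≡ y)

record K4Vertex (t : Tree) : Set where
  field
    k     : ℕ
    x     : Pos t
    lp    : ℕ
    lq    : ℕ
    p     : Vec ℕ lp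
    q     : Vec ℕ lq
    degx  : 3 ≤ deg x
    len   : lp + lq ≡ deg x ∸ 1
    ppos  : Any (λ e → 0 < e) p
    total : sum p + sum q + k ≡ 3     -- i.e. sum of entries = 3 - k

open K4Vertex

-- one-sided adjacency condition (v plays the role of (k₁,x₁,p₁,q₁))
K4Rel : ∀ {t} → K4Vertex t → K4Vertex t → Set
K4Rel v w =
    ((¬ Stacked (x v) (x w)) × (4 ≤ k v + k w))
  ⊎ (Σ (Fin (lp v)) λ i → OnDir (x v) (suc (toℕ i)) (x w) ×
       ( (4 < lookup (p v) i + k w)
       ⊎ ((lookup (p v) i + k w ≡ 4) ×
          (Σ (Fin (lp v)) λ j → j ≢ i × lookup (p v) j ≢ 0))))
  ⊎ (Σ (Fin (lq v)) λ j → OnDir (x v) (suc (lp v + toℕ j)) (x w) ×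
       (4 < lookup (q v) j + k w))

K4Adj : ∀ {t} → K4Vertex t → K4Vertex t → Set
K4Adj v w = K4Rel v w ⊎ K4Rel w v

{-# OPTIONS --safe #-}
-- Send each vertex (k, x, p, q) of the clique to x.  Since the entries of p and q and k
-- sum to 3 and p ≠ 0, an edge v → w of K₄T has one of two shapes: k v = k w = 2 with
-- x v, x w unstacked, or k w = 2 with x w in a direction i of x v where pᵢ ≥ 2 (so that
-- k v < 2 and i is the only such direction).  In the first case the meet of x v and x w
-- is a branching vertex strictly between them.  In the second, a third clique vertex c
-- must hang below x v in the same direction i with k c = 2, hence unstacked from x w, and
-- the meet of x w and x c is a branching vertex strictly between x v and x w.
module Submission where

open import Defs
open import Data.Nat using (ℕ; suc; _+_; _≤_; z≤n; s≤s)
open import Data.Nat.Properties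
  using (≤-refl; ≤-trans; ≤-reflexive; ≤-antisym; <-irrefl; +-comm; +-mono-≤; +-monoˡ-≤;
         +-monoʳ-≤; +-cancelˡ-≤; +-cancelʳ-≤; m≤m+n; m≤n+m; m+n≤o⇒m≤o; n≢0⇒n>0)
open import Data.Fin using (Fin; toℕ; _≟_) renaming (zero to fzero; suc to fsuc)
open import Data.Vec using (Vec; _∷_; lookup; sum)
import Data.Vec.Relation.Unary.Any as Any
open import Data.Vec.Relation.Unary.Any.Properties using (lookup-index)
open import Data.Product using (Σ; _×_; _,_; proj₁; proj₂; ∃-syntax) renaming (map to ×-map)
open import Data.Sum using (inj₁; inj₂; [_,_]) renaming (map to ⊎-map; swap to ⊎-swap)
open import Data.Empty using (⊥-elim)
open import Function using (_∘_; id)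
open import Relation.Nullary using (¬_; yes; no; contradiction)
open import Relation.Binary.PropositionalEquality using (_≡_; _≢_; refl; sym; cong; subst)

open K4Vertex

private
  variable
    t : Tree
    n : ℕ

+-tight : ∀ {m n a b} → m ≤ a → n ≤ b → a + b ≤ m + n → m ≡ a × n ≡ b
+-tight {m} {n} {a} {b} m≤a n≤b a+b≤m+n =
  ≤-antisym m≤a (+-cancelʳ-≤ n a m (≤-trans (+-monoʳ-≤ a n≤b) a+b≤m+n)) ,
  ≤-antisym n≤b (+-cancelˡ-≤ m b n (≤-trans (+-monoˡ-≤ b m≤a) a+b≤m+n))

lookup≤sum : (v : Vec ℕ n) (i : Fin n) → lookup v i ≤ sum v
lookup≤sum (a ∷ v) fzero    = m≤m+n a (sum v)
lookup≤sum (a ∷ v) (fsuc i) = ≤-trans (lookup≤sum v i) (m≤n+m (sum v) a)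

lookup+lookup≤sum : (v : Vec ℕ n) {i j : Fin n} → i ≢ j → lookup v i + lookup v j ≤ sum v
lookup+lookup≤sum (a ∷ v) {fzero}  {fzero}  i≢j = contradiction refl i≢j
lookup+lookup≤sum (a ∷ v) {fzero}  {fsuc j} _   = +-monoʳ-≤ a (lookup≤sum v j)
lookup+lookup≤sum (a ∷ v) {fsuc i} {fzero}  _   =
  subst (_≤ a + sum v) (+-comm a _) (+-monoʳ-≤ a (lookup≤sum v i))
lookup+lookup≤sum (a ∷ v) {fsuc i} {fsuc j} i≢j =
  ≤-trans (lookup+lookup≤sum v (i≢j ∘ cong fsuc)) (m≤n+m (sum v) a)

≼-refl : (a : Pos t) → a ≼ a
≼-refl here      = here≼
≼-refl (down a)  = down≼ (≼-refl a)
≼-refl (left a)  = left≼ (≼-refl a)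
≼-refl (right a) = right≼ (≼-refl a)

≼-trans : {a b c : Pos t} → a ≼ b → b ≼ c → a ≼ c
≼-trans here≼      _           = here≼
≼-trans (down≼ u)  (down≼ v)  = down≼ (≼-trans u v)
≼-trans (left≼ u)  (left≼ v)  = left≼ (≼-trans u v)
≼-trans (right≼ u) (right≼ v) = right≼ (≼-trans u v)

≡⇒Stacked : {a b : Pos t} → a ≡ b → Stacked a b
≡⇒Stacked {a = a} refl = inj₁ (≼-refl a)

OnDir⇒≼ : {a b : Pos t} {i : ℕ} → OnDir a i b → a ≼ b
OnDir⇒≼ dir-down     = here≼
OnDir⇒≼ dir-left     = here≼
OnDir⇒≼ dir-right    = here≼
OnDir⇒≼ (in-down d)  = down≼ (OnDir⇒≼ d)
OnDir⇒≼ (in-left d)  = left≼ (OnDir⇒≼ d)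
OnDir⇒≼ (in-right d) = right≼ (OnDir⇒≼ d)

OnDir⇒≢ : {a b : Pos t} {i : ℕ} → OnDir a i b → a ≢ b
OnDir⇒≢ dir-down     ()
OnDir⇒≢ dir-left     ()
OnDir⇒≢ dir-right    ()
OnDir⇒≢ (in-down d)  refl = OnDir⇒≢ d refl
OnDir⇒≢ (in-left d)  refl = OnDir⇒≢ d refl
OnDir⇒≢ (in-right d) refl = OnDir⇒≢ d refl

down-injective : {a b : Pos t} → down a ≡ down b → a ≡ b
down-injective refl = refl

left-injective : ∀ {l r} {a b : Pos l} → left {r = r} a ≡ left b → a ≡ b
left-injective refl = refl

right-injective : ∀ {l r} {a b : Pos r} → right {l = l} a ≡ right b → a ≡ b
right-injective refl = refl

infixl 25 _⊓_

_⊓_ : Pos t → Pos t → Pos t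
down a  ⊓ down b  = down (a ⊓ b)
left a  ⊓ left b  = left (a ⊓ b)
right a ⊓ right b = right (a ⊓ b)
_       ⊓ _       = here

⊓-lower : (a b : Pos t) → a ⊓ b ≼ a × a ⊓ b ≼ b
⊓-lower here      _         = here≼ , here≼
⊓-lower (down a)  here      = here≼ , here≼
⊓-lower (down a)  (down b)  = ×-map down≼ down≼ (⊓-lower a b)
⊓-lower (left a)  here      = here≼ , here≼
⊓-lower (left a)  (left b)  = ×-map left≼ left≼ (⊓-lower a b)
⊓-lower (left a)  (right b) = here≼ , here≼
⊓-lower (right a) here      = here≼ , here≼
⊓-lower (right a) (left b)  = here≼ , here≼
⊓-lower (right a) (right b) = ×-map right≼ right≼ (⊓-lower a b)

⊓-greatest : {a b c : Pos t} → c ≼ a → c ≼ b → c ≼ a ⊓ b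
⊓-greatest here≼      _           = here≼
⊓-greatest (down≼ u)  (down≼ v)  = down≼ (⊓-greatest u v)
⊓-greatest (left≼ u)  (left≼ v)  = left≼ (⊓-greatest u v)
⊓-greatest (right≼ u) (right≼ v) = right≼ (⊓-greatest u v)

⊓-branching : (a b : Pos t) → ¬ Stacked a b → InF (a ⊓ b)
⊓-branching (down a)  (down b)  ns = ⊓-branching a b (ns ∘ ⊎-map down≼ down≼)
⊓-branching (left a)  (left b)  ns = ⊓-branching a b (ns ∘ ⊎-map left≼ left≼)
⊓-branching (right a) (right b) ns = ⊓-branching a b (ns ∘ ⊎-map right≼ right≼)
⊓-branching (left a)  (right b) _  = ≤-refl
⊓-branching (right a) (left b)  _  = ≤-refl
⊓-branching here      _         ns = ⊥-elim (ns (inj₁ here≼))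
⊓-branching _         here      ns = ⊥-elim (ns (inj₂ here≼))

⊓≢ˡ : {a b : Pos t} → ¬ Stacked a b → a ⊓ b ≢ a
⊓≢ˡ {a = a} {b} ns eq = ns (inj₁ (subst (_≼ b) eq (proj₂ (⊓-lower a b))))

⊓≢ʳ : {a b : Pos t} → ¬ Stacked a b → a ⊓ b ≢ b
⊓≢ʳ {a = a} {b} ns eq = ns (inj₂ (subst (_≼ a) eq (proj₁ (⊓-lower a b))))

OnDir-⊓ : {a b c : Pos t} {i : ℕ} → OnDir a i b → OnDir a i c → a ≢ b ⊓ c
OnDir-⊓ dir-down     dir-down      ()
OnDir-⊓ dir-left     dir-left      ()
OnDir-⊓ dir-right    dir-right     ()
OnDir-⊓ (in-down d)  (in-down d')  = OnDir-⊓ d d' ∘ down-injective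
OnDir-⊓ (in-left d)  (in-left d')  = OnDir-⊓ d d' ∘ left-injective
OnDir-⊓ (in-right d) (in-right d') = OnDir-⊓ d d' ∘ right-injective

FAdj-sym : {a b : Pos t} → FAdj a b → FAdj b a
FAdj-sym (a≢b , only) =
  a≢b ∘ sym , λ z (z≼ , meet) → ⊎-swap ∘ only z (⊎-swap z≼ , λ w u v → meet w v u)

branchInside⇒¬FAdj : {a b z : Pos t} → OnPath a b z → InF z → z ≢ a → z ≢ b → ¬ FAdj a b
branchInside⇒¬FAdj on inF z≢a z≢b (_ , only) = [ z≢a , z≢b ] (only _ on inF)

unstacked⇒¬FAdj : {a b : Pos t} → ¬ Stacked a b → ¬ FAdj a b
unstacked⇒¬FAdj {a = a} {b} ns =
  branchInside⇒¬FAdj (inj₁ (proj₁ (⊓-lower a b)) , λ _ → ⊓-greatest)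
    (⊓-branching a b ns) (⊓≢ˡ ns) (⊓≢ʳ ns)

sameDir⇒¬FAdj : {a b c : Pos t} {i : ℕ} →
                OnDir a i b → OnDir a i c → ¬ Stacked b c → ¬ FAdj a b
sameDir⇒¬FAdj {b = b} {c} a→b a→c ns =
  branchInside⇒¬FAdj
    (inj₂ (proj₁ (⊓-lower b c)) , λ _ w≼a w≼b → ⊓-greatest w≼b (≼-trans w≼a (OnDir⇒≼ a→c)))
    (⊓-branching b c ns) (OnDir-⊓ a→b a→c ∘ sym) (⊓≢ˡ ns)

module _ (v : K4Vertex t) where

  1≤sum-p : 1 ≤ sum (p v)
  1≤sum-p = ≤-trans (lookup-index (ppos v)) (lookup≤sum (p v) (Any.index (ppos v)))

  sum-p+k≤3 : sum (p v) + k v ≤ 3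
  sum-p+k≤3 = ≤-trans (+-monoˡ-≤ (k v) (m≤m+n (sum (p v)) (sum (q v)))) (≤-reflexive (total v))

  k≤2 : k v ≤ 2
  k≤2 = +-cancelˡ-≤ 1 (k v) 2 (≤-trans (+-monoˡ-≤ (k v) 1≤sum-p) sum-p+k≤3)

  p-entry+k≤3 : (i : Fin (lp v)) → lookup (p v) i + k v ≤ 3
  p-entry+k≤3 i = ≤-trans (+-monoˡ-≤ (k v) (lookup≤sum (p v) i)) sum-p+k≤3

  p-entries≤3 : {i j : Fin (lp v)} → i ≢ j → lookup (p v) i + lookup (p v) j ≤ 3
  p-entries≤3 i≢j = ≤-trans (lookup+lookup≤sum (p v) i≢j) (m+n≤o⇒m≤o (sum (p v)) sum-p+k≤3)

  q-entry≤2 : (j : Fin (lq v)) → lookup (q v) j ≤ 2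
  q-entry≤2 j = +-cancelˡ-≤ 1 (lookup (q v) j) 2
    (≤-trans (+-mono-≤ 1≤sum-p (lookup≤sum (q v) j))
             (m+n≤o⇒m≤o (sum (p v) + sum (q v)) (≤-reflexive (total v))))

  heavy⇒k≢2 : {i : Fin (lp v)} → 2 ≤ lookup (p v) i → k v ≢ 2
  heavy⇒k≢2 {i} heavy k≡2 =
    <-irrefl refl (≤-trans (+-mono-≤ heavy (≤-reflexive (sym k≡2))) (p-entry+k≤3 i))

  heavy-unique : {i j : Fin (lp v)} → 2 ≤ lookup (p v) i → 2 ≤ lookup (p v) j → i ≡ j
  heavy-unique {i} {j} heavyᵢ heavyⱼ with i ≟ j
  ... | yes i≡j = i≡j
  ... | no  i≢j = ⊥-elim (<-irrefl refl (≤-trans (+-mono-≤ heavyᵢ heavyⱼ) (p-entries≤3 i≢j)))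

data RelShape (v w : K4Vertex t) : Set where
  unstacked : k v ≡ 2 → k w ≡ 2 → ¬ Stacked (x v) (x w) → RelShape v w
  heavy     : k w ≡ 2 → (i : Fin (lp v)) → OnDir (x v) (suc (toℕ i)) (x w) →
              2 ≤ lookup (p v) i → RelShape v w

relShape : (v w : K4Vertex t) → K4Rel v w → RelShape v w
relShape v w (inj₁ (ns , 4≤k+k)) =
  let kv≡2 , kw≡2 = +-tight (k≤2 v) (k≤2 w) 4≤k+k in unstacked kv≡2 kw≡2 ns
relShape v w (inj₂ (inj₁ (i , dir , inj₁ 4<pᵢ+k))) =
  let pᵢ≡3 , kw≡2 = +-tight (m+n≤o⇒m≤o _ (p-entry+k≤3 v i)) (k≤2 w) 4<pᵢ+k
  in heavy kw≡2 i dir (subst (2 ≤_) (sym pᵢ≡3) (s≤s (s≤s z≤n)))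
relShape v w (inj₂ (inj₁ (i , dir , inj₂ (pᵢ+k≡4 , j , j≢i , pⱼ≢0)))) =
  let pᵢ≤2 = +-cancelʳ-≤ 1 _ 2 (≤-trans (+-monoʳ-≤ _ (n≢0⇒n>0 pⱼ≢0)) (p-entries≤3 v (j≢i ∘ sym)))
      pᵢ≡2 , kw≡2 = +-tight pᵢ≤2 (k≤2 w) (≤-reflexive (sym pᵢ+k≡4))
  in heavy kw≡2 i dir (≤-reflexive (sym pᵢ≡2))
relShape v w (inj₂ (inj₂ (j , _ , 4<qⱼ+k))) =
  ⊥-elim (<-irrefl refl (≤-trans 4<qⱼ+k (+-mono-≤ (q-entry≤2 v j) (k≤2 w))))

K4Rel⇒k≡2 : (v w : K4Vertex t) → K4Rel v w → k w ≡ 2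
K4Rel⇒k≡2 v w r with relShape v w r
... | unstacked _ kw≡2 _ = kw≡2
... | heavy kw≡2 _ _ _   = kw≡2

K4Rel⇒unstacked : (v w : K4Vertex t) → k v ≡ 2 → K4Rel v w → ¬ Stacked (x v) (x w)
K4Rel⇒unstacked v w kv≡2 r with relShape v w r
... | unstacked _ _ ns     = ns
... | heavy _ _ _ heavyᵢ = contradiction kv≡2 (heavy⇒k≢2 v heavyᵢ)

K4Rel⇒≢ : (v w : K4Vertex t) → K4Rel v w → x v ≢ x w
K4Rel⇒≢ v w r with relShape v w r
... | unstacked _ _ ns = ns ∘ ≡⇒Stacked
... | heavy _ _ dir _  = OnDir⇒≢ dir

K4Adj⇒≢ : (v w : K4Vertex t) → K4Adj v w → x v ≢ x w
K4Adj⇒≢ v w = [ K4Rel⇒≢ v w , (λ r → K4Rel⇒≢ w v r ∘ sym) ]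

triangle⇒¬FAdj′ : (a b c : K4Vertex t) →
                  K4Rel a b → K4Adj a c → K4Adj b c → ¬ FAdj (x a) (x b)
triangle⇒¬FAdj′ a b c ab ac bc with relShape a b ab
... | unstacked _ _ ns = unstacked⇒¬FAdj ns
triangle⇒¬FAdj′ a b c ab ac bc | heavy kb≡2 i a→b heavyᵢ =
  sameDir⇒¬FAdj a→b a→c bc-unstacked
  where
  ka≢2 : k a ≢ 2
  ka≢2 = heavy⇒k≢2 a heavyᵢ

  rel-ac : K4Rel a c
  rel-ac = [ id , (λ ca → contradiction (K4Rel⇒k≡2 c a ca) ka≢2) ] ac

  a→c : OnDir (x a) (suc (toℕ i)) (x c)
  a→c with relShape a c rel-ac
  ... | unstacked ka≡2 _ _ = contradiction ka≡2 ka≢2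
  ... | heavy _ j a→ⱼc heavyⱼ with heavy-unique a {i} {j} heavyᵢ heavyⱼ
  ...   | refl = a→ⱼc

  bc-unstacked : ¬ Stacked (x b) (x c)
  bc-unstacked =
    [ K4Rel⇒unstacked b c kb≡2 , (λ cb → K4Rel⇒unstacked c b (K4Rel⇒k≡2 a c rel-ac) cb ∘ ⊎-swap) ] bc

triangle⇒¬FAdj : (a b c : K4Vertex t) →
                 K4Adj a b → K4Adj a c → K4Adj b c → ¬ FAdj (x a) (x b)
triangle⇒¬FAdj a b c (inj₁ ab) ac bc = triangle⇒¬FAdj′ a b c ab ac bc
triangle⇒¬FAdj a b c (inj₂ ba) ac bc = triangle⇒¬FAdj′ b a c ba bc ac ∘ FAdj-sym

avoid₂ : (i j : Fin (3 + n)) → ∃[ l ] l ≢ i × l ≢ j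
avoid₂ fzero           fzero           = fsuc fzero , (λ ()) , (λ ())
avoid₂ fzero           (fsuc fzero)    = fsuc (fsuc fzero) , (λ ()) , (λ ())
avoid₂ fzero           (fsuc (fsuc _)) = fsuc fzero , (λ ()) , (λ ())
avoid₂ (fsuc fzero)    fzero           = fsuc (fsuc fzero) , (λ ()) , (λ ())
avoid₂ (fsuc fzero)    (fsuc _)        = fzero , (λ ()) , (λ ())
avoid₂ (fsuc (fsuc _)) fzero           = fsuc fzero , (λ ()) , (λ ())
avoid₂ (fsuc (fsuc _)) (fsuc _)        = fzero , (λ ()) , (λ ())

mainTheorem6 : (t : Tree) (m : ℕ) → 3 ≤ m
    → (f : Fin m → K4Vertex t) → (∀ i j → i ≢ j → K4Adj (f i) (f j))
    → Σ (Fin m → Pos t) λ g → (∀ i → InF (g i)) × (∀ i j → i ≢ j → g i ≢ g j)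
        × (∀ i j → i ≢ j → ¬ FAdj (g i) (g j))
mainTheorem6 t (suc (suc (suc _))) (s≤s (s≤s (s≤s _))) f adj =
  x ∘ f , degx ∘ f , distinct , independent
  where
  distinct : ∀ i j → i ≢ j → x (f i) ≢ x (f j)
  distinct i j i≢j = K4Adj⇒≢ (f i) (f j) (adj i j i≢j)

  independent : ∀ i j → i ≢ j → ¬ FAdj (x (f i)) (x (f j))
  independent i j i≢j with avoid₂ i j
  ... | l , l≢i , l≢j =
    triangle⇒¬FAdj (f i) (f j) (f l) (adj i j i≢j) (adj i l (l≢i ∘ sym)) (adj j l (l≢j ∘ sym))
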